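{- Let $v\in V$ and $c\in C$ with $\mathbf{dist}(v,c)<\infty$. Let $i_1\le i_2$ be integers in $\{0,\dots,k-1\}$ such that the sequence $i_1,\dots,i_2$ has more than one element and is $(v,c)$-feasible. Put $i=\lceil (i_1+i_2)/2\rceil$, and let $j$ be an index in $\{i_1,\dots,i-1\}$ that maximizes $\Delta_j(v)$. If $p_j(v)\notin B(c)$, then the sequence $i,\dots,i_2$ is $(v,c)$-feasible. Otherwise the sequence $i_1,\dots,j$ is $(v,c)$-feasible. In either case the new sequence has at most $\frac{2}{3}(i_2-i_1+1)$ elements.
   Context: $G=(V,E)$ is an undirected graph with nonnegative edge weights, $c:V\to C$ is a coloring, and $k\ge 1$ is an integer. $\mathbf{dist}$ is the shortest-path distance, $V_c=\{u:c(u)=c\}$ and $\mathbf{dist}(v,c)=\min_{u\in V_c}\mathbf{dist}(v,u)$. $V=A_0\supseteq A_1\supseteq\cdots\supseteq A_{k-1}$ are nested vertex sets (in the construction, obtained by random sampling), and $A_k=\emptyset$. $p_i(v)$ is a vertex of $A_i$ closest to $v$, with $\mathbf{dist}(v,p_k(v))=\infty$. For $0\le i<k-1$, $\Delta_i(v)=\mathbf{dist}(v,p_{i+1}(v))-\mathbf{dist}(v,p_i(v))$. $B(u)=\bigcup_{i=0}^{k-1}\{x\in A_i\setminus A_{i+1}:\mathbf{dist}(u,x)<\mathbf{dist}(u,p_{i+1}(u))\}$ and $B(c)=\bigcup_{u\in V_c}B(u)$. An index $j\in\{0,\dots,k-1\}$ is $(v,c)$-terminal if $p_j(v)\in B(c)$.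 A sequence of consecutive integers $i_1,\dots,i_2$ with $0\le i_1\le i_2\le k-1$ is $(v,c)$-feasible if (1) $\mathbf{dist}(v,p_{i_1}(v))\le 2i_1\,\mathbf{dist}(v,c)$ and (2) $i_2$ is $(v,c)$-terminal.
   Formalization: The edge weights of G are nonnegative rationals, so the shortest-path distances, including $\mathbf{dist}(v,c)$, are rational or infinite. -}

module Defs where

open import Data.Nat as ℕ using (ℕ; zero; suc; _<?_)
open import Data.Fin using (Fin)
open import Data.Integer using (+_)
open import Data.Rational as ℚ using (ℚ; 0ℚ; _/_)
open import Data.Product using (Σ; _×_; _,_)
open import Data.Sum using (_⊎_)
open import Data.Empty using (⊥)
open import Data.Unit using (⊤)
open import Relation.Nullary using (¬_; yes; no)
open import Relation.Binary.PropositionalEquality using (_≡_)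

data ℚ∞ : Set where
  fin : ℚ → ℚ∞
  ∞   : ℚ∞

infix 4 _≤∞_ _<∞_
_≤∞_ : ℚ∞ → ℚ∞ → Set
fin a ≤∞ fin b = a ℚ.≤ b
fin a ≤∞ ∞     = ⊤
∞     ≤∞ fin b = ⊥
∞     ≤∞ ∞     = ⊤

_<∞_ : ℚ∞ → ℚ∞ → Set
fin a <∞ fin b = a ℚ.< b
fin a <∞ ∞     = ⊤
∞     <∞ _     = ⊥

-- difference (monus convention: x - ∞ := 0, in particular ∞ - ∞ = 0)
infixl 6 _-∞_
_-∞_ : ℚ∞ → ℚ∞ → ℚ∞
fin a -∞ fin b = fin (a ℚ.- b)
∞     -∞ fin b = ∞
_     -∞ ∞     = fin 0ℚ

-- multiplication by a natural number (convention 0 · ∞ = 0)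
infixl 7 _·∞_
_·∞_ : ℕ → ℚ∞ → ℚ∞
m     ·∞ fin a = fin ((+ m / 1) ℚ.* a)
zero  ·∞ ∞     = fin 0ℚ
suc m ·∞ ∞     = ∞

record Graph (n : ℕ) : Set₁ where
  field
    E        : Fin n → Fin n → Set
    E-sym    : ∀ {u v} → E u v → E v u
    w        : Fin n → Fin n → ℚ
    w-sym    : ∀ {u v} → E u v → w u v ≡ w v u
    w-nonneg : ∀ {u v} → E u v → 0ℚ ℚ.≤ w u v

module _ {n : ℕ} (G : Graph n) where
  open Graph G

  data Walk : Fin n → Fin n → Set where
    []  : ∀ {u} → Walk u u
    _∷_ : ∀ {u x v} → E u x → Walk x v → Walk u v

  weight : ∀ {u v} → Walk u v → ℚ
  weight [] = 0ℚ
  weight (_∷_ {u} {x} e q) = w u x ℚ.+ weight q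

  IsShortestPathDist : (Fin n → Fin n → ℚ∞) → Set
  IsShortestPathDist d = ∀ u v →
    (∀ (q : Walk u v) → d u v ≤∞ fin (weight q)) ×
    ((Σ (Walk u v) λ q → d u v ≡ fin (weight q)) ⊎ (d u v ≡ ∞ × ¬ Walk u v))

module _ {n : ℕ} (d : Fin n → Fin n → ℚ∞) {C : Set} (col : Fin n → C)
         (k : ℕ) (A : ℕ → Fin n → Set) (p : ℕ → Fin n → Fin n) where

  IsDistToColor : Fin n → C → ℚ∞ → Set
  IsDistToColor v c δ =
    (∀ u → col u ≡ c → δ ≤∞ d v u) ×
    ((Σ (Fin n) λ u → col u ≡ c × δ ≡ d v u) ⊎ (δ ≡ ∞ × (∀ u → ¬ col u ≡ c)))

  -- dist(v, p_i(v)), with dist(v, p_k(v)) = ∞ (A_k = ∅)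
  distP : ℕ → Fin n → ℚ∞
  distP i v with i <? k
  ... | yes _ = d v (p i v)
  ... | no  _ = ∞

  Δ : ℕ → Fin n → ℚ∞
  Δ i v = distP (suc i) v -∞ distP i v

  InB : Fin n → Fin n → Set
  InB x u = Σ ℕ λ i → i ℕ.< k × A i x × ¬ A (suc i) x × d u x <∞ distP (suc i) u

  InBc : Fin n → C → Set
  InBc x c = Σ (Fin n) λ u → col u ≡ c × InB x u

  Terminal : Fin n → C → ℕ → Set
  Terminal v c j = j ℕ.< k × InBc (p j v) c

  Feasible : Fin n → C → ℚ∞ → ℕ → ℕ → Set
  Feasible v c δ i₁ i₂ =
    i₁ ℕ.≤ i₂ × i₂ ℕ.< k ×
    distP i₁ v ≤∞ (2 ℕ.* i₁) ·∞ δ ×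
    Terminal v c i₂

{-# OPTIONS --safe #-}
module Submission where

-- Let u be a vertex of colour c with dist(v,u) = δ = dist(v,c), and x = p_j(v). If x ∉ B(c)
-- then x ∉ B(u), which forces dist(u, p_{j+1}(u)) ≤ dist(u,x): either x ∈ A_{j+1} and
-- p_{j+1}(u) is a nearest point of A_{j+1}, or x ∈ A_j ∖ A_{j+1} and this is exactly what
-- x ∉ B(u) says. Hence dist(v, p_{j+1}(v)) ≤ δ + dist(u, p_{j+1}(u)) ≤ δ + dist(u,x)
-- ≤ 2δ + dist(v,x), i.e. Δ_j(v) ≤ 2δ. As j maximises Δ on [i₁, i), summing the increments
-- from i₁ to i yields dist(v, p_i(v)) ≤ 2 i₁ δ + 2 (i - i₁) δ = 2 i δ. If instead x ∈ B(c),
-- then j is terminal. The size bounds are arithmetic on i = i₁ + ⌈(i₂ - i₁)/2⌉.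

open import Defs
open import Data.Nat using (ℕ; suc; _+_; _*_; _∸_; _≤_; _<_; ⌈_/2⌉)
open import Data.Fin using (Fin)
open import Data.Rational using (ℚ)
open import Data.Product using (Σ; _×_)
open import Data.Empty using (⊥)
open import Relation.Nullary using (¬_)

open import Level using (0ℓ)
open import Data.Nat using (zero; _<?_; ⌊_/2⌋; z≤n; _≤′_; ≤′-refl; ≤′-step)
import Data.Nat.Properties as ℕP
open import Data.Integer as ℤ using (+_)
import Data.Integer.Properties as ℤP
open import Data.Rational as ℚ using (0ℚ; 1ℚ; _/_)
import Data.Rational.Properties as ℚP
import Data.Rational.Unnormalised as ℚᵘ
import Data.Rational.Unnormalised.Properties as ℚᵘP
open import Algebra.Properties.Group ℚP.+-0-group using (//-rightDividesˡ; //-rightDividesʳ)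
open import Data.Product using (_,_; proj₁; proj₂)
open import Data.Sum using (inj₁; inj₂)
open import Data.Unit using (tt)
open import Relation.Nullary using (yes; no; contradiction)
open import Relation.Nullary.Decidable using (Dec; decidable-stable; ¬¬-excluded-middle)
open import Relation.Nullary.Negation using (¬¬-map)
open import Relation.Binary using (Decidable; IsPreorder; Preorder)
open import Relation.Binary.PropositionalEquality
import Relation.Binary.Reasoning.Preorder as PreorderReasoning

⌈m+[m+n]/2⌉≡m+⌈n/2⌉ : ∀ m n → ⌈ m + (m + n) /2⌉ ≡ m + ⌈ n /2⌉
⌈m+[m+n]/2⌉≡m+⌈n/2⌉ zero    n = refl
⌈m+[m+n]/2⌉≡m+⌈n/2⌉ (suc m) n =
  trans (cong (λ x → ⌈ suc x /2⌉) (ℕP.+-suc m (m + n))) (cong suc (⌈m+[m+n]/2⌉≡m+⌈n/2⌉ m n))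

1+n∸⌈n/2⌉≡1+⌊n/2⌋ : ∀ n → suc n ∸ ⌈ n /2⌉ ≡ suc ⌊ n /2⌋
1+n∸⌈n/2⌉≡1+⌊n/2⌋ n = begin
  suc n ∸ ⌈ n /2⌉                         ≡⟨ cong (λ x → suc x ∸ ⌈ n /2⌉) (ℕP.⌊n/2⌋+⌈n/2⌉≡n n) ⟨
  suc ⌊ n /2⌋ + ⌈ n /2⌉ ∸ ⌈ n /2⌉         ≡⟨ ℕP.m+n∸n≡m (suc ⌊ n /2⌋) ⌈ n /2⌉ ⟩
  suc ⌊ n /2⌋                             ∎
  where open ≡-Reasoning

3⌈n/2⌉≤1+2n : ∀ n → 3 * ⌈ n /2⌉ ≤ suc (2 * n)
3[1+⌈n/2⌉]≤2[2+n] : ∀ n → 3 * suc ⌈ n /2⌉ ≤ 2 * (2 + n)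

3⌈n/2⌉≤1+2n zero          = z≤n
3⌈n/2⌉≤1+2n (suc zero)    = ℕP.≤-refl
3⌈n/2⌉≤1+2n (suc (suc n)) = ℕP.m≤n⇒m≤1+n (3[1+⌈n/2⌉]≤2[2+n] n)

3[1+⌈n/2⌉]≤2[2+n] n = begin
  3 * suc ⌈ n /2⌉         ≡⟨ ℕP.*-suc 3 ⌈ n /2⌉ ⟩
  3 + 3 * ⌈ n /2⌉         ≤⟨ ℕP.+-monoʳ-≤ 3 (3⌈n/2⌉≤1+2n n) ⟩
  2 * 2 + 2 * n           ≡⟨ ℕP.*-distribˡ-+ 2 2 n ⟨
  2 * (2 + n)             ∎
  where open ℕP.≤-Reasoning

module Halving {i₁ i₂ : ℕ} (i₁<i₂ : i₁ < i₂) where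
  private
    n : ℕ
    n = i₂ ∸ i₁

    i₁≤i₂ : i₁ ≤ i₂
    i₁≤i₂ = ℕP.<⇒≤ i₁<i₂

    i₁+n≡i₂ : i₁ + n ≡ i₂
    i₁+n≡i₂ = ℕP.m+[n∸m]≡n i₁≤i₂

    mid≡i₁+⌈n/2⌉ : ⌈ i₁ + i₂ /2⌉ ≡ i₁ + ⌈ n /2⌉
    mid≡i₁+⌈n/2⌉ = trans (cong (λ x → ⌈ i₁ + x /2⌉) (sym i₁+n≡i₂)) (⌈m+[m+n]/2⌉≡m+⌈n/2⌉ i₁ n)

    1+i₂∸i₁≡1+n : suc i₂ ∸ i₁ ≡ suc n
    1+i₂∸i₁≡1+n = ℕP.+-∸-assoc 1 i₁≤i₂

  i₁<mid : i₁ < ⌈ i₁ + i₂ /2⌉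
  i₁<mid = subst (i₁ <_) (sym mid≡i₁+⌈n/2⌉) (ℕP.m<m+n i₁ (ℕP.⌈n/2⌉-mono (ℕP.m<n⇒0<n∸m i₁<i₂)))

  mid≤i₂ : ⌈ i₁ + i₂ /2⌉ ≤ i₂
  mid≤i₂ = subst₂ _≤_ (sym mid≡i₁+⌈n/2⌉) i₁+n≡i₂ (ℕP.+-monoʳ-≤ i₁ (ℕP.⌈n/2⌉≤n n))

  upper-half-size : 3 * (suc i₂ ∸ ⌈ i₁ + i₂ /2⌉) ≤ 2 * (suc i₂ ∸ i₁)
  upper-half-size = subst₂ (λ a b → 3 * a ≤ 2 * b) (sym upper-length) (sym 1+i₂∸i₁≡1+n)
                           (bound n (ℕP.m<n⇒0<n∸m i₁<i₂))
    where
    upper-length : suc i₂ ∸ ⌈ i₁ + i₂ /2⌉ ≡ suc ⌊ n /2⌋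
    upper-length = begin
      suc i₂ ∸ ⌈ i₁ + i₂ /2⌉        ≡⟨ cong (suc i₂ ∸_) mid≡i₁+⌈n/2⌉ ⟩
      suc i₂ ∸ (i₁ + ⌈ n /2⌉)       ≡⟨ ℕP.∸-+-assoc (suc i₂) i₁ ⌈ n /2⌉ ⟨
      suc i₂ ∸ i₁ ∸ ⌈ n /2⌉         ≡⟨ cong (_∸ ⌈ n /2⌉) 1+i₂∸i₁≡1+n ⟩
      suc n ∸ ⌈ n /2⌉               ≡⟨ 1+n∸⌈n/2⌉≡1+⌊n/2⌋ n ⟩
      suc ⌊ n /2⌋                   ∎
      where open ≡-Reasoning
    bound : ∀ m → 0 < m → 3 * suc ⌊ m /2⌋ ≤ 2 * suc m
    bound (suc m) _ = 3[1+⌈n/2⌉]≤2[2+n] m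

  lower-half-size : ∀ {j} → j < ⌈ i₁ + i₂ /2⌉ → 3 * (suc j ∸ i₁) ≤ 2 * (suc i₂ ∸ i₁)
  lower-half-size {j} j<mid = begin
    3 * (suc j ∸ i₁)             ≤⟨ ℕP.*-monoʳ-≤ 3 (ℕP.∸-monoˡ-≤ i₁ j<mid) ⟩
    3 * (⌈ i₁ + i₂ /2⌉ ∸ i₁)     ≡⟨ cong (λ x → 3 * (x ∸ i₁)) mid≡i₁+⌈n/2⌉ ⟩
    3 * (i₁ + ⌈ n /2⌉ ∸ i₁)      ≡⟨ cong (3 *_) (ℕP.m+n∸m≡n i₁ ⌈ n /2⌉) ⟩
    3 * ⌈ n /2⌉                  ≤⟨ 3⌈n/2⌉≤1+2n n ⟩
    suc (2 * n)                  ≤⟨ ℕP.n≤1+n _ ⟩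
    2 + 2 * n                    ≡⟨ ℕP.*-suc 2 n ⟨
    2 * suc n                    ≡⟨ cong (2 *_) 1+i₂∸i₁≡1+n ⟨
    2 * (suc i₂ ∸ i₁)            ∎
    where open ℕP.≤-Reasoning

infixl 6 _+∞_
_+∞_ : ℚ∞ → ℚ∞ → ℚ∞
fin a +∞ fin b = fin (a ℚ.+ b)
_     +∞ _     = ∞

+∞-zeroʳ : ∀ a → a +∞ ∞ ≡ ∞
+∞-zeroʳ (fin a) = refl
+∞-zeroʳ ∞       = refl

+∞-assoc : ∀ a b c → (a +∞ b) +∞ c ≡ a +∞ (b +∞ c)
+∞-assoc (fin a) (fin b) (fin c) = cong fin (ℚP.+-assoc a b c)
+∞-assoc (fin a) (fin b) ∞       = refl
+∞-assoc (fin a) ∞       c       = refl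
+∞-assoc ∞       b       c       = refl

≤∞-refl : ∀ {a} → a ≤∞ a
≤∞-refl {fin a} = ℚP.≤-refl
≤∞-refl {∞}     = tt

≤∞-trans : ∀ {a b c} → a ≤∞ b → b ≤∞ c → a ≤∞ c
≤∞-trans {fin a} {fin b} {fin c} a≤b b≤c = ℚP.≤-trans a≤b b≤c
≤∞-trans {fin a} {b}     {∞}     _   _   = tt
≤∞-trans {∞}     {∞}     {∞}     _   _   = tt
≤∞-trans {fin a} {∞}     {fin c} _   ()
≤∞-trans {∞}     {∞}     {fin c} _   ()

≤∞-isPreorder : IsPreorder _≡_ _≤∞_
≤∞-isPreorder = record
  { isEquivalence = isEquivalence
  ; reflexive     = λ { refl → ≤∞-refl }
  ; trans         = ≤∞-trans
  }

≤∞-preorder : Preorder 0ℓ 0ℓ 0ℓ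
≤∞-preorder = record { isPreorder = ≤∞-isPreorder }

module ≤∞-Reasoning = PreorderReasoning ≤∞-preorder

a≤∞∞ : ∀ a → a ≤∞ ∞
a≤∞∞ (fin a) = tt
a≤∞∞ ∞       = tt

_≤∞?_ : Decidable _≤∞_
fin a ≤∞? fin b = a ℚ.≤? b
fin a ≤∞? ∞     = yes tt
∞     ≤∞? fin b = no (λ ())
∞     ≤∞? ∞     = yes tt

≮∞⇒≥∞ : ∀ {a b} → ¬ a <∞ b → b ≤∞ a
≮∞⇒≥∞ {fin a} {fin b} a≮b = ℚP.≮⇒≥ a≮b
≮∞⇒≥∞ {fin a} {∞}     a≮b = contradiction tt a≮b
≮∞⇒≥∞ {∞}     {b}     _   = a≤∞∞ b

+∞-monoʳ-≤ : ∀ a {b c} → b ≤∞ c → a +∞ b ≤∞ a +∞ c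
+∞-monoʳ-≤ (fin a) {fin b} {fin c} b≤c = ℚP.+-monoʳ-≤ a b≤c
+∞-monoʳ-≤ (fin a) {b}     {∞}     _   = a≤∞∞ (fin a +∞ b)
+∞-monoʳ-≤ (fin a) {∞}     {fin c} ()
+∞-monoʳ-≤ ∞                       _   = tt

+∞-monoˡ-≤ : ∀ {a b} c → a ≤∞ b → a +∞ c ≤∞ b +∞ c
+∞-monoˡ-≤ {fin a} {fin b} (fin c) a≤b = ℚP.+-monoˡ-≤ c a≤b
+∞-monoˡ-≤ {a}     {b}     ∞       _   = subst₂ _≤∞_ (sym (+∞-zeroʳ a)) (sym (+∞-zeroʳ b)) tt
+∞-monoˡ-≤ {fin a} {∞}     (fin c) _   = tt
+∞-monoˡ-≤ {∞}     {∞}     (fin c) _   = tt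
+∞-monoˡ-≤ {∞}     {fin b} (fin c) ()

-∞-≤⇒≤+∞ : ∀ {a b D} → b -∞ a ≤∞ fin D → b ≤∞ fin D +∞ a
-∞-≤⇒≤+∞ {fin a} {fin b} {D} b-a≤D =
  subst (ℚ._≤ D ℚ.+ a) (//-rightDividesˡ a b) (ℚP.+-monoˡ-≤ a b-a≤D)
-∞-≤⇒≤+∞ {fin a} {∞}     ()
-∞-≤⇒≤+∞ {∞}     {b}     _ = a≤∞∞ b

-- 0 ≤ D is needed for a = ∞, where b -∞ ∞ = 0.
≤+∞⇒-∞-≤ : ∀ {a b D} → 0ℚ ℚ.≤ D → b ≤∞ fin D +∞ a → b -∞ a ≤∞ fin D
≤+∞⇒-∞-≤ {fin a} {fin b} {D} _ b≤D+a =
  subst (b ℚ.- a ℚ.≤_) (//-rightDividesʳ a D) (ℚP.+-monoˡ-≤ (ℚ.- a) b≤D+a)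
≤+∞⇒-∞-≤ {fin a} {∞}     _   ()
≤+∞⇒-∞-≤ {∞}     {fin b} 0≤D _ = 0≤D
≤+∞⇒-∞-≤ {∞}     {∞}     0≤D _ = 0≤D

/1-homo-+ : ∀ m n → + (m + n) / 1 ≡ + m / 1 ℚ.+ + n / 1
/1-homo-+ m n = ℚP.toℚᵘ-injective (begin
  ℚ.toℚᵘ (+ (m + n) / 1)                      ≈⟨ ℚP.toℚᵘ-fromℚᵘ (ℚᵘ.mkℚᵘ (+ (m + n)) 0) ⟩
  ℚᵘ.mkℚᵘ (+ (m + n)) 0                       ≈⟨ ℚᵘ.*≡* (cong (ℤ._* + 1) sums) ⟩
  ℚᵘ.mkℚᵘ (+ m) 0 ℚᵘ.+ ℚᵘ.mkℚᵘ (+ n) 0        ≈⟨ ℚᵘP.+-cong (ℚP.toℚᵘ-fromℚᵘ (ℚᵘ.mkℚᵘ (+ m) 0))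
                                                              (ℚP.toℚᵘ-fromℚᵘ (ℚᵘ.mkℚᵘ (+ n) 0)) ⟨
  ℚ.toℚᵘ (+ m / 1) ℚᵘ.+ ℚ.toℚᵘ (+ n / 1)      ≈⟨ ℚP.toℚᵘ-homo-+ (+ m / 1) (+ n / 1) ⟨
  ℚ.toℚᵘ (+ m / 1 ℚ.+ + n / 1)                ∎)
  where
  open ℚᵘP.≃-Reasoning
  sums : + (m + n) ≡ + m ℤ.* + 1 ℤ.+ + n ℤ.* + 1
  sums = trans (ℤP.pos-+ m n) (sym (cong₂ ℤ._+_ (ℤP.*-identityʳ (+ m)) (ℤP.*-identityʳ (+ n))))

interval-induction : (P : ℕ → Set) {a b : ℕ} → a ≤′ b → P a →
                     (∀ {m} → a ≤ m → m < b → P m → P (suc m)) → P b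
interval-induction P ≤′-refl       Pa step = Pa
interval-induction P (≤′-step a≤b) Pa step =
  step (ℕP.≤′⇒≤ a≤b) ℕP.≤-refl
       (interval-induction P a≤b Pa (λ a≤m m<b → step a≤m (ℕP.m<n⇒m<1+n m<b)))

2*[1+m]·∞-fin : ∀ m δ → (2 * suc m) ·∞ fin δ ≡ fin (δ ℚ.+ δ) +∞ (2 * m) ·∞ fin δ
2*[1+m]·∞-fin m δ = cong fin (begin
  (+ (2 * suc m) / 1) ℚ.* δ                     ≡⟨ cong (λ i → (+ i / 1) ℚ.* δ) (ℕP.*-suc 2 m) ⟩
  (+ (2 + 2 * m) / 1) ℚ.* δ                     ≡⟨ cong (ℚ._* δ) (/1-homo-+ 2 (2 * m)) ⟩
  (+ 2 / 1 ℚ.+ + (2 * m) / 1) ℚ.* δ             ≡⟨ ℚP.*-distribʳ-+ δ (+ 2 / 1) (+ (2 * m) / 1) ⟩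
  (+ 2 / 1) ℚ.* δ ℚ.+ (+ (2 * m) / 1) ℚ.* δ     ≡⟨ cong (ℚ._+ (+ (2 * m) / 1) ℚ.* δ) 2δ≡δ+δ ⟩
  δ ℚ.+ δ ℚ.+ (+ (2 * m) / 1) ℚ.* δ             ∎)
  where
  open ≡-Reasoning
  2δ≡δ+δ : (+ 2 / 1) ℚ.* δ ≡ δ ℚ.+ δ
  2δ≡δ+δ = trans (ℚP.*-distribʳ-+ δ 1ℚ 1ℚ) (cong₂ ℚ._+_ (ℚP.*-identityˡ δ) (ℚP.*-identityˡ δ))

linear-growth : (f : ℕ → ℚ∞) {δ : ℚ} {a b : ℕ} → a ≤ b →
                (∀ {m} → a ≤ m → m < b → f (suc m) -∞ f m ≤∞ fin (δ ℚ.+ δ)) →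
                f a ≤∞ (2 * a) ·∞ fin δ → f b ≤∞ (2 * b) ·∞ fin δ
linear-growth f {δ} {a} {b} a≤b increment≤ fa≤ =
  interval-induction (λ i → f i ≤∞ (2 * i) ·∞ fin δ) (ℕP.≤⇒≤′ a≤b) fa≤ step
  where
  step : ∀ {m} → a ≤ m → m < b → f m ≤∞ (2 * m) ·∞ fin δ → f (suc m) ≤∞ (2 * suc m) ·∞ fin δ
  step {m} a≤m m<b fm≤ = begin
    f (suc m)                            ≲⟨ -∞-≤⇒≤+∞ (increment≤ a≤m m<b) ⟩
    fin (δ ℚ.+ δ) +∞ f m                 ≲⟨ +∞-monoʳ-≤ (fin (δ ℚ.+ δ)) fm≤ ⟩
    fin (δ ℚ.+ δ) +∞ (2 * m) ·∞ fin δ    ≡⟨ 2*[1+m]·∞-fin m δ ⟨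
    (2 * suc m) ·∞ fin δ                 ∎
    where open ≤∞-Reasoning

module _ {n : ℕ} {G : Graph n} where
  open Graph G using (E-sym; w; w-sym; w-nonneg)

  infixr 5 _++ʷ_
  _++ʷ_ : ∀ {a b c} → Walk G a b → Walk G b c → Walk G a c
  []      ++ʷ r = r
  (e ∷ q) ++ʷ r = e ∷ (q ++ʷ r)

  reverseʷ : ∀ {a b} → Walk G a b → Walk G b a
  reverseʷ []      = []
  reverseʷ (e ∷ q) = reverseʷ q ++ʷ (E-sym e ∷ [])

  weight-++ʷ : ∀ {a b c} (q : Walk G a b) (r : Walk G b c) →
               weight G (q ++ʷ r) ≡ weight G q ℚ.+ weight G r
  weight-++ʷ []                    r = sym (ℚP.+-identityˡ (weight G r))
  weight-++ʷ (_∷_ {a} {x} e q) r =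
    trans (cong (w a x ℚ.+_) (weight-++ʷ q r)) (sym (ℚP.+-assoc (w a x) (weight G q) (weight G r)))

  weight-reverseʷ : ∀ {a b} (q : Walk G a b) → weight G (reverseʷ q) ≡ weight G q
  weight-reverseʷ []                = refl
  weight-reverseʷ (_∷_ {a} {x} e q) = begin
    weight G (reverseʷ q ++ʷ (E-sym e ∷ []))   ≡⟨ weight-++ʷ (reverseʷ q) (E-sym e ∷ []) ⟩
    weight G (reverseʷ q) ℚ.+ (w x a ℚ.+ 0ℚ)   ≡⟨ cong₂ ℚ._+_ (weight-reverseʷ q) (ℚP.+-identityʳ (w x a)) ⟩
    weight G q ℚ.+ w x a                       ≡⟨ cong (weight G q ℚ.+_) (w-sym e) ⟨
    weight G q ℚ.+ w a x                       ≡⟨ ℚP.+-comm (weight G q) (w a x) ⟩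
    w a x ℚ.+ weight G q                       ∎
    where open ≡-Reasoning

  weight-nonneg : ∀ {a b} (q : Walk G a b) → 0ℚ ℚ.≤ weight G q
  weight-nonneg []      = ℚP.≤-refl
  weight-nonneg (e ∷ q) = ℚP.+-mono-≤ (w-nonneg e) (weight-nonneg q)

module ShortestPath {n : ℕ} {G : Graph n} {d : Fin n → Fin n → ℚ∞}
                    (d-spd : IsShortestPathDist G d) where

  d≤weight : ∀ {a b} (q : Walk G a b) → d a b ≤∞ fin (weight G q)
  d≤weight {a} {b} = proj₁ (d-spd a b)

  d-triangle : ∀ a b c → d a c ≤∞ d a b +∞ d b c
  d-triangle a b c with proj₂ (d-spd a b) | proj₂ (d-spd b c)
  ... | inj₁ (q , dab≡q) | inj₁ (r , dbc≡r) = begin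
    d a c                                  ≲⟨ d≤weight (q ++ʷ r) ⟩
    fin (weight G (q ++ʷ r))               ≡⟨ cong fin (weight-++ʷ q r) ⟩
    fin (weight G q) +∞ fin (weight G r)   ≡⟨ cong₂ _+∞_ dab≡q dbc≡r ⟨
    d a b +∞ d b c                         ∎
    where open ≤∞-Reasoning
  ... | inj₁ _ | inj₂ (dbc≡∞ , _) =
    subst (d a c ≤∞_) (trans (sym (+∞-zeroʳ (d a b))) (cong (d a b +∞_) (sym dbc≡∞))) (a≤∞∞ (d a c))
  ... | inj₂ (dab≡∞ , _) | _ = subst (λ x → d a c ≤∞ x +∞ d b c) (sym dab≡∞) (a≤∞∞ (d a c))

  d-sym-≤ : ∀ a b → d a b ≤∞ d b a
  d-sym-≤ a b with proj₂ (d-spd b a)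
  ... | inj₁ (q , dba≡q) =
    subst (d a b ≤∞_) (trans (cong fin (weight-reverseʷ q)) (sym dba≡q)) (d≤weight (reverseʷ q))
  ... | inj₂ (dba≡∞ , _) = subst (d a b ≤∞_) (sym dba≡∞) (a≤∞∞ (d a b))

  d-nonneg : ∀ {a b x} → d a b ≡ fin x → 0ℚ ℚ.≤ x
  d-nonneg {a} {b} dab≡x with proj₂ (d-spd a b)
  ... | inj₁ (q , dab≡q) with trans (sym dab≡x) dab≡q
  ...   | refl = weight-nonneg q
  d-nonneg dab≡x | inj₂ (dab≡∞ , _) with trans (sym dab≡x) dab≡∞
  ...   | ()

module Hierarchy {n : ℕ} {G : Graph n} {d : Fin n → Fin n → ℚ∞} (d-spd : IsShortestPathDist G d)
                 {C : Set} (col : Fin n → C) (k : ℕ) (A : ℕ → Fin n → Set) (p : ℕ → Fin n → Fin n)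
                 (A-k-empty : ∀ x → ¬ A k x)
                 (p-nearest : ∀ i → i < k → ∀ v → A i (p i v) × (∀ x → A i x → d v (p i v) ≤∞ d v x))
                 where
  open ShortestPath d-spd

  dist-p : ℕ → Fin n → ℚ∞
  dist-p = distP d col k A p

  dist-p-< : ∀ {i v} → i < k → dist-p i v ≡ d v (p i v)
  dist-p-< {i} i<k with i <? k
  ... | yes _   = refl
  ... | no  i≮k = contradiction i<k i≮k

  dist-p-≤ : ∀ {i u x} → i ≤ k → A i x → dist-p i u ≤∞ d u x
  dist-p-≤ {i} {u} {x} i≤k x∈Aᵢ with ℕP.m≤n⇒m<n∨m≡n i≤k
  ... | inj₁ i<k  = subst (_≤∞ d u x) (sym (dist-p-< i<k)) (proj₂ (p-nearest i i<k u) x x∈Aᵢ)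
  ... | inj₂ refl = contradiction x∈Aᵢ (A-k-empty x)

  dist-p-lipschitz : ∀ i v u → dist-p i v ≤∞ d v u +∞ dist-p i u
  dist-p-lipschitz i v u with i <? k
  ... | yes i<k = begin
    d v (p i v)                ≲⟨ proj₂ (p-nearest i i<k v) (p i u) (proj₁ (p-nearest i i<k u)) ⟩
    d v (p i u)                ≲⟨ d-triangle v u (p i u) ⟩
    d v u +∞ d u (p i u)       ∎
    where open ≤∞-Reasoning
  ... | no _ = subst (∞ ≤∞_) (sym (+∞-zeroʳ (d v u))) tt

  -- Membership in A_{j+1} need not be decidable, but the conclusion is, so excluded middle
  -- may be used under a double negation.
  dist-p-suc-≤ : ∀ {j u x} → j < k → A j x → ¬ InB d col k A p x u → dist-p (suc j) u ≤∞ d u x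
  dist-p-suc-≤ {j} {u} {x} j<k x∈Aⱼ x∉Bᵤ =
    decidable-stable (dist-p (suc j) u ≤∞? d u x) (¬¬-map by-level ¬¬-excluded-middle)
    where
    by-level : Dec (A (suc j) x) → dist-p (suc j) u ≤∞ d u x
    by-level (yes x∈Aⱼ₊₁) = dist-p-≤ j<k x∈Aⱼ₊₁
    by-level (no  x∉Aⱼ₊₁) = ≮∞⇒≥∞ (λ dux< → x∉Bᵤ (j , j<k , x∈Aⱼ , x∉Aⱼ₊₁ , dux<))

  nearest-of-colour : ∀ {v c δ} → IsDistToColor d col k A p v c (fin δ) →
                      Σ (Fin n) λ u → col u ≡ c × d v u ≡ fin δ
  nearest-of-colour (_ , inj₁ (u , colᵤ≡c , δ≡dvu)) = u , colᵤ≡c , sym δ≡dvu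
  nearest-of-colour (_ , inj₂ (() , _))

  Δ-≤-2δ : ∀ {c u v δ j} → col u ≡ c → d v u ≡ fin δ → j < k → ¬ InBc d col k A p (p j v) c →
           Δ d col k A p j v ≤∞ fin (δ ℚ.+ δ)
  Δ-≤-2δ {c} {u} {v} {δ} {j} colᵤ≡c dvu≡δ j<k pⱼ∉Bc = ≤+∞⇒-∞-≤ 0≤δ+δ (begin
    dist-p (suc j) v                  ≲⟨ dist-p-lipschitz (suc j) v u ⟩
    d v u +∞ dist-p (suc j) u         ≲⟨ +∞-monoʳ-≤ (d v u) (dist-p-suc-≤ j<k pⱼ∈Aⱼ pⱼ∉Bᵤ) ⟩
    d v u +∞ d u x                    ≲⟨ +∞-monoʳ-≤ (d v u) (d-triangle u v x) ⟩
    d v u +∞ (d u v +∞ d v x)         ≲⟨ +∞-monoʳ-≤ (d v u) (+∞-monoˡ-≤ (d v x) (d-sym-≤ u v)) ⟩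
    d v u +∞ (d v u +∞ d v x)         ≡⟨ cong₂ (λ a b → a +∞ (a +∞ b)) dvu≡δ (sym (dist-p-< j<k)) ⟩
    fin δ +∞ (fin δ +∞ dist-p j v)    ≡⟨ +∞-assoc (fin δ) (fin δ) (dist-p j v) ⟨
    fin (δ ℚ.+ δ) +∞ dist-p j v       ∎)
    where
    open ≤∞-Reasoning
    x : Fin n
    x = p j v
    pⱼ∈Aⱼ : A j x
    pⱼ∈Aⱼ = proj₁ (p-nearest j j<k v)
    pⱼ∉Bᵤ : ¬ InB d col k A p x u
    pⱼ∉Bᵤ x∈Bᵤ = pⱼ∉Bc (u , colᵤ≡c , x∈Bᵤ)
    0≤δ+δ : 0ℚ ℚ.≤ δ ℚ.+ δ
    0≤δ+δ = ℚP.+-mono-≤ (d-nonneg dvu≡δ) (d-nonneg dvu≡δ)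

lemma2 : {n : ℕ} (G : Graph n) (d : Fin n → Fin n → ℚ∞) → IsShortestPathDist G d →
  {C : Set} (col : Fin n → C) (k : ℕ) → 1 ≤ k →
  (A : ℕ → Fin n → Set) →
  (∀ v → A 0 v) →
  (∀ i → i < k → ∀ v → A (suc i) v → A i v) →
  (∀ v → ¬ A k v) →
  (p : ℕ → Fin n → Fin n) →
  (∀ i → i < k → ∀ v → A i (p i v) × (∀ x → A i x → d v (p i v) ≤∞ d v x)) →
  (v : Fin n) (c : C) (δ : ℚ) → IsDistToColor d col k A p v c (fin δ) →
  (i₁ i₂ : ℕ) → i₁ < i₂ → i₂ < k →
  Feasible d col k A p v c (fin δ) i₁ i₂ →
  (j : ℕ) → i₁ ≤ j → j < ⌈ i₁ + i₂ /2⌉ →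
  (∀ j′ → i₁ ≤ j′ → j′ < ⌈ i₁ + i₂ /2⌉ → Δ d col k A p j′ v ≤∞ Δ d col k A p j v) →
  (¬ InBc d col k A p (p j v) c →
     Feasible d col k A p v c (fin δ) ⌈ i₁ + i₂ /2⌉ i₂ ×
     3 * (suc i₂ ∸ ⌈ i₁ + i₂ /2⌉) ≤ 2 * (suc i₂ ∸ i₁)) ×
  (InBc d col k A p (p j v) c →
     Feasible d col k A p v c (fin δ) i₁ j ×
     3 * (suc j ∸ i₁) ≤ 2 * (suc i₂ ∸ i₁))
lemma2 G d d-spd col k _ A _ _ A-k-empty p p-nearest v c δ v-to-c i₁ i₂ i₁<i₂ i₂<k
       (_ , _ , i₁-start , i₂-terminal) j i₁≤j j<mid Δⱼ-max =
    (λ pⱼ∉Bc → (mid≤i₂ , i₂<k , mid-start pⱼ∉Bc , i₂-terminal) , upper-half-size)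
  , (λ pⱼ∈Bc → (i₁≤j , j<k , i₁-start , j<k , pⱼ∈Bc) , lower-half-size j<mid)
  where
  open Hierarchy d-spd col k A p A-k-empty p-nearest
  open Halving i₁<i₂
  j<k : j < k
  j<k = ℕP.<-trans (ℕP.<-≤-trans j<mid mid≤i₂) i₂<k
  mid-start : ¬ InBc d col k A p (p j v) c → dist-p ⌈ i₁ + i₂ /2⌉ v ≤∞ (2 * ⌈ i₁ + i₂ /2⌉) ·∞ fin δ
  mid-start pⱼ∉Bc with nearest-of-colour v-to-c
  ... | u , colᵤ≡c , dvu≡δ =
    linear-growth (λ i → dist-p i v) (ℕP.<⇒≤ i₁<mid)
      (λ {m} i₁≤m m<mid → ≤∞-trans (Δⱼ-max m i₁≤m m<mid) (Δ-≤-2δ colᵤ≡c dvu≡δ j<k pⱼ∉Bc))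
      i₁-start
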